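{- Let $n\ge1$ and $1\le j\le n$. Then $t_jF_{n-j}=P_{n,e_j}$, i.e. $t_jF_{n-j}$ is the weighted isobaric polynomial of level $n$ whose weight vector is the $j$-th unit vector $e_j=(0,\ldots,0,1,0,\ldots)$.
   Context: Let $t_1,t_2,\ldots$ be indeterminates. For $\alpha=(\alpha_1,\alpha_2,\ldots)$ a finitely supported vector of nonnegative integers write $t^\alpha=\prod_i t_i^{\alpha_i}$, $|\alpha|=\sum_i\alpha_i$, and $\alpha\vdash n$ if $\sum_i i\alpha_i=n$. For a weight vector $\omega=(\omega_1,\omega_2,\ldots)$ define $A_\omega(e_i)=\omega_i$ ($e_i$ the $i$-th unit vector) and, for $|\alpha|\ge2$, $A_\omega(\alpha)=\sum_{i:\alpha_i\ge1}A_\omega(\alpha-e_i)$; the weighted isobaric polynomial of level $n$ and weight $\omega$ is $P_{n,\omega}=\sum_{\alpha\vdash n}A_\omega(\alpha)t^\alpha$. Let $F_m=P_{m,(1,1,1,\ldots)}$ for $m\ge1$ (the generalized Fibonacci polynomials) and $F_0=1$. -}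

module Defs where

open import Data.Nat using (ℕ; zero; suc; _+_; _*_; _∸_; _≡ᵇ_)
open import Data.List using (List; []; _∷_)
open import Data.Nat.ListAction using (sum)
open import Data.Bool using (if_then_else_)

-- A monomial t^α in t_1, t_2, ... is represented by its exponent list
-- α = (α_1, α_2, ..., α_k) (entry at 0-based position i is α_{i+1});
-- exponents beyond the end of the list are 0 (so lists differing by
-- trailing zeros denote the same monomial; all definitions below respect this).
Exp : Set
Exp = List ℕ

-- A (formal) polynomial in t_1, t_2, ... with ℕ coefficients is given by its
-- coefficient function on exponent vectors.
Poly : Set
Poly = Exp → ℕ

-- Weight vectors ω = (ω_1, ω_2, ...), 0-based: ω i = ω_{i+1}.
Weight : Set
Weight = ℕ → ℕ

∣_∣ₑ : Exp → ℕ
∣ α ∣ₑ = sum α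

levelFrom : ℕ → Exp → ℕ
levelFrom k []       = 0
levelFrom k (a ∷ as) = suc k * a + levelFrom (suc k) as

level : Exp → ℕ
level = levelFrom 0

-- Σ_{i : α_i ≥ 1} g (α - e_i)
sumDec : (Exp → ℕ) → Exp → ℕ
sumDec g []           = 0
sumDec g (zero ∷ as)  = sumDec (λ bs → g (zero ∷ bs)) as
sumDec g (suc a ∷ as) = g (a ∷ as) + sumDec (λ bs → g (suc a ∷ bs)) as

-- Σ_{i : α_i ≥ 1} ω_i ; for α = e_i this is exactly ω_i.
sumWeight : Weight → Exp → ℕ
sumWeight ω []           = 0
sumWeight ω (zero ∷ as)  = sumWeight (λ i → ω (suc i)) as
sumWeight ω (suc a ∷ as) = ω 0 + sumWeight (λ i → ω (suc i)) as

-- A_ω with fuel: A_ω(e_i) = ω_i, and for |α| ≥ 2,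
-- A_ω(α) = Σ_{i : α_i ≥ 1} A_ω(α - e_i).
AFuel : ℕ → Weight → Exp → ℕ
AFuel zero    ω α = 0
AFuel (suc f) ω α =
  if ∣ α ∣ₑ ≡ᵇ 1 then sumWeight ω α else sumDec (AFuel f ω) α

-- A_ω(α) for |α| ≥ 1 (value at α = 0 is irrelevant and set to 0).
A : Weight → Exp → ℕ
A ω α = AFuel ∣ α ∣ₑ ω α

P : ℕ → Weight → Poly
P n ω α = if level α ≡ᵇ n then A ω α else 0

ones : Weight
ones _ = 1

F : ℕ → Poly
F zero    α = if ∣ α ∣ₑ ≡ᵇ 0 then 1 else 0
F (suc m) α = P (suc m) ones α

-- unit weight vector e_j (j 1-based): ω_i = 1 iff i = j
unitW : ℕ → Weight
unitW j i = if suc i ≡ᵇ j then 1 else 0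

-- multiplication by t_{k+1} (k 0-based):
-- coefficient of t^α in t_{k+1} Q is Q(α - e_{k+1}) if α_{k+1} ≥ 1, else 0
mulT₀ : ℕ → Poly → Poly
mulT₀ zero    Q []           = 0
mulT₀ zero    Q (zero ∷ as)  = 0
mulT₀ zero    Q (suc a ∷ as) = Q (a ∷ as)
mulT₀ (suc k) Q []           = 0
mulT₀ (suc k) Q (a ∷ as)     = mulT₀ k (λ bs → Q (a ∷ bs)) as

mulT : ℕ → Poly → Poly
mulT j = mulT₀ (j ∸ 1)

-- Write A₁ for A_{(1,1,…)} extended by A₁(0) = 1, so that F_m is the level-m part of A₁ for
-- every m ≥ 0 and A₁ satisfies A₁(β) = Σ_{i : β_i ≥ 1} A₁(β − e_i) whenever |β| ≥ 1.
-- By induction on |α| one gets A_{e_j}(α) = [α_j ≥ 1] · A₁(α − e_j): unfolding A_{e_j}(α) once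
-- and applying the induction hypothesis gives Σ_i [α_i ≥ 1] [(α − e_i)_j ≥ 1] A₁(α − e_i − e_j),
-- and the double indicator is symmetric in i and j, so the sum collapses to the A₁-recursion
-- at α − e_j. Since level(α − e_j) = level(α) − j, this is the coefficient of t^α in t_j F_{n−j}.
module Submission where

open import Defs
open import Data.Nat using (ℕ; zero; suc; _+_; _*_; _∸_; _≡ᵇ_; _≤_; s≤s; pred; _≟_)
open import Data.Nat.Properties using (+-identityʳ; *-zeroʳ; +-suc; suc-injective; m+n≡0⇒m≡0; m+n≡0⇒n≡0; 1+n≢0)
open import Data.Nat.Solver using (module +-*-Solver)
open import Data.List using ([]; _∷_; length)
open import Data.Bool using (Bool; true; false; if_then_else_)
open import Data.Empty using (⊥-elim)
open import Relation.Nullary using (¬_; yes; no; contradiction)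
open import Relation.Binary.PropositionalEquality
open ≡-Reasoning

ifPos : ℕ → ℕ → ℕ
ifPos zero    _ = 0
ifPos (suc _) y = y

extendAt0 : ℕ → ℕ → ℕ
extendAt0 zero    _ = 1
extendAt0 (suc _) y = y

ifPos-cong : ∀ a {y z} → (∀ {x} → a ≡ suc x → y ≡ z) → ifPos a y ≡ ifPos a z
ifPos-cong zero    _  = refl
ifPos-cong (suc x) eq = eq refl

ifPos-zero : ∀ a → ifPos a 0 ≡ 0
ifPos-zero zero    = refl
ifPos-zero (suc _) = refl

ifPos-comm : ∀ a b y → ifPos a (ifPos b y) ≡ ifPos b (ifPos a y)
ifPos-comm zero    b       y = sym (ifPos-zero b)
ifPos-comm (suc _) zero    y = refl
ifPos-comm (suc _) (suc _) y = refl

ifPos-if : ∀ a (b : Bool) y → ifPos a (if b then y else 0) ≡ (if b then ifPos a y else 0)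
ifPos-if a true  y = refl
ifPos-if a false y = ifPos-zero a

sumBelow : ℕ → (ℕ → ℕ) → ℕ
sumBelow zero    f = 0
sumBelow (suc n) f = f 0 + sumBelow n (λ i → f (suc i))

sumBelow-cong : ∀ n {f g : ℕ → ℕ} → (∀ i → f i ≡ g i) → sumBelow n f ≡ sumBelow n g
sumBelow-cong zero    eq = refl
sumBelow-cong (suc n) eq = cong₂ _+_ (eq 0) (sumBelow-cong n (λ i → eq (suc i)))

sumBelow-zero : ∀ n → sumBelow n (λ _ → 0) ≡ 0
sumBelow-zero zero    = refl
sumBelow-zero (suc n) = sumBelow-zero n

sumBelow-ifPos : ∀ n a f → sumBelow n (λ i → ifPos a (f i)) ≡ ifPos a (sumBelow n f)
sumBelow-ifPos n zero    f = sumBelow-zero n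
sumBelow-ifPos n (suc _) f = refl

coord : ℕ → Exp → ℕ
coord i       []       = 0
coord zero    (a ∷ as) = a
coord (suc i) (a ∷ as) = coord i as

decr : ℕ → Exp → Exp
decr i       []       = []
decr zero    (a ∷ as) = pred a ∷ as
decr (suc i) (a ∷ as) = a ∷ decr i as

length-decr : ∀ i α → length (decr i α) ≡ length α
length-decr i       []       = refl
length-decr zero    (a ∷ as) = refl
length-decr (suc i) (a ∷ as) = cong suc (length-decr i as)

decr-comm : ∀ i k α → decr k (decr i α) ≡ decr i (decr k α)
decr-comm i       k       []       = refl
decr-comm zero    zero    (a ∷ as) = refl
decr-comm zero    (suc k) (a ∷ as) = refl
decr-comm (suc i) zero    (a ∷ as) = refl
decr-comm (suc i) (suc k) (a ∷ as) = cong (a ∷_) (decr-comm i k as)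

coord-decr-≢ : ∀ i k α → ¬ i ≡ k → coord k (decr i α) ≡ coord k α
coord-decr-≢ i       k       []       _   = refl
coord-decr-≢ zero    zero    (a ∷ as) i≢k = ⊥-elim (i≢k refl)
coord-decr-≢ zero    (suc k) (a ∷ as) _   = refl
coord-decr-≢ (suc i) zero    (a ∷ as) _   = refl
coord-decr-≢ (suc i) (suc k) (a ∷ as) i≢k = coord-decr-≢ i k as (λ i≡k → i≢k (cong suc i≡k))

ifPos-coord-decr-swap : ∀ i k α y →
  ifPos (coord i α) (ifPos (coord k (decr i α)) y) ≡ ifPos (coord k α) (ifPos (coord i (decr k α)) y)
ifPos-coord-decr-swap i k α y with i ≟ k
... | yes refl = refl
... | no i≢k rewrite coord-decr-≢ i k α i≢k | coord-decr-≢ k i α (λ k≡i → i≢k (sym k≡i)) =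
  ifPos-comm (coord i α) (coord k α) y

suc-∣decr∣ : ∀ i α {x} → coord i α ≡ suc x → suc ∣ decr i α ∣ₑ ≡ ∣ α ∣ₑ
suc-∣decr∣ zero    (suc a ∷ as) refl = refl
suc-∣decr∣ (suc i) (a ∷ as)     αᵢ≡  = trans (sym (+-suc a _)) (cong (a +_) (suc-∣decr∣ i as αᵢ≡))

∣decr∣ : ∀ i α {x s} → coord i α ≡ suc x → ∣ α ∣ₑ ≡ suc s → ∣ decr i α ∣ₑ ≡ s
∣decr∣ i α αᵢ≡ ∣α∣≡ = suc-injective (trans (suc-∣decr∣ i α αᵢ≡) ∣α∣≡)

coord-∣∣≡0 : ∀ i α → ∣ α ∣ₑ ≡ 0 → coord i α ≡ 0
coord-∣∣≡0 i       []       _  = refl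
coord-∣∣≡0 zero    (a ∷ as) eq = m+n≡0⇒m≡0 a eq
coord-∣∣≡0 (suc i) (a ∷ as) eq = coord-∣∣≡0 i as (m+n≡0⇒n≡0 a eq)

levelFrom-decr : ∀ o k α {x} → coord k α ≡ suc x →
  levelFrom o α ≡ levelFrom o (decr k α) + (o + suc k)
levelFrom-decr o zero (suc a ∷ as) refl =
  solve 3 (λ o a L → (con 1 :+ o) :* (con 1 :+ a) :+ L := ((con 1 :+ o) :* a :+ L) :+ (o :+ con 1))
    refl o a (levelFrom (suc o) as)
  where open +-*-Solver
levelFrom-decr o (suc k) (a ∷ as) αₖ≡ = begin
  suc o * a + levelFrom (suc o) as                             ≡⟨ cong (suc o * a +_) (levelFrom-decr (suc o) k as αₖ≡) ⟩
  suc o * a + (levelFrom (suc o) (decr k as) + (suc o + suc k)) ≡⟨ solve 4 (λ x L o k →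
                                                                     x :+ (L :+ (con 1 :+ o :+ (con 1 :+ k))) := x :+ L :+ (o :+ (con 2 :+ k)))
                                                                     refl (suc o * a) (levelFrom (suc o) (decr k as)) o k ⟩
  suc o * a + levelFrom (suc o) (decr k as) + (o + suc (suc k)) ∎
  where open +-*-Solver

∣∣≡0⇒levelFrom≡0 : ∀ o α → ∣ α ∣ₑ ≡ 0 → levelFrom o α ≡ 0
∣∣≡0⇒levelFrom≡0 o []       _  = refl
∣∣≡0⇒levelFrom≡0 o (a ∷ as) eq rewrite m+n≡0⇒m≡0 a eq | *-zeroʳ o =
  ∣∣≡0⇒levelFrom≡0 (suc o) as (m+n≡0⇒n≡0 a eq)

levelFrom≡0⇒∣∣≡0 : ∀ o α → levelFrom o α ≡ 0 → ∣ α ∣ₑ ≡ 0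
levelFrom≡0⇒∣∣≡0 o []       _  = refl
levelFrom≡0⇒∣∣≡0 o (a ∷ as) eq =
  cong₂ _+_ a≡0 (levelFrom≡0⇒∣∣≡0 (suc o) as (m+n≡0⇒n≡0 (suc o * a) eq))
  where
  a≡0 : a ≡ 0
  a≡0 = m+n≡0⇒m≡0 a (m+n≡0⇒m≡0 (suc o * a) eq)

sumDec-coord : ∀ g α → sumDec g α ≡ sumBelow (length α) (λ i → ifPos (coord i α) (g (decr i α)))
sumDec-coord g []           = refl
sumDec-coord g (zero ∷ as)  = sumDec-coord (λ bs → g (zero ∷ bs)) as
sumDec-coord g (suc a ∷ as) = cong (g (a ∷ as) +_) (sumDec-coord (λ bs → g (suc a ∷ bs)) as)

sumWeight-coord : ∀ ω α → sumWeight ω α ≡ sumBelow (length α) (λ i → ifPos (coord i α) (ω i))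
sumWeight-coord ω []           = refl
sumWeight-coord ω (zero ∷ as)  = sumWeight-coord (λ i → ω (suc i)) as
sumWeight-coord ω (suc a ∷ as) = cong (ω 0 +_) (sumWeight-coord (λ i → ω (suc i)) as)

sumWeight-zero : ∀ α → sumWeight (λ _ → 0) α ≡ 0
sumWeight-zero []           = refl
sumWeight-zero (zero ∷ as)  = sumWeight-zero as
sumWeight-zero (suc a ∷ as) = sumWeight-zero as

sumWeight-unitW : ∀ k α → sumWeight (unitW (suc k)) α ≡ ifPos (coord k α) 1
sumWeight-unitW k       []           = refl
sumWeight-unitW zero    (zero ∷ as)  = sumWeight-zero as
sumWeight-unitW zero    (suc a ∷ as) = cong suc (sumWeight-zero as)
sumWeight-unitW (suc k) (zero ∷ as)  = sumWeight-unitW k as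
sumWeight-unitW (suc k) (suc a ∷ as) = sumWeight-unitW k as

mulT₀-coord : ∀ k Q α → mulT₀ k Q α ≡ ifPos (coord k α) (Q (decr k α))
mulT₀-coord zero    Q []           = refl
mulT₀-coord zero    Q (zero ∷ as)  = refl
mulT₀-coord zero    Q (suc a ∷ as) = refl
mulT₀-coord (suc k) Q []           = refl
mulT₀-coord (suc k) Q (a ∷ as)     = mulT₀-coord k (λ bs → Q (a ∷ bs)) as

A-unfold : ∀ ω α {f} → ∣ α ∣ₑ ≡ suc f →
  A ω α ≡ (if suc f ≡ᵇ 1 then sumWeight ω α else sumDec (AFuel f ω) α)
A-unfold ω α {f} ∣α∣≡ = begin
  AFuel ∣ α ∣ₑ ω α  ≡⟨ cong (λ s → AFuel s ω α) ∣α∣≡ ⟩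
  AFuel (suc f) ω α ≡⟨ cong (λ s → if s ≡ᵇ 1 then sumWeight ω α else sumDec (AFuel f ω) α) ∣α∣≡ ⟩
  (if suc f ≡ᵇ 1 then sumWeight ω α else sumDec (AFuel f ω) α) ∎

A-unit : ∀ ω α → ∣ α ∣ₑ ≡ 1 → A ω α ≡ sumWeight ω α
A-unit ω α = A-unfold ω α

A-step : ∀ ω α {m} → ∣ α ∣ₑ ≡ suc (suc m) →
  A ω α ≡ sumBelow (length α) (λ i → ifPos (coord i α) (A ω (decr i α)))
A-step ω α {m} ∣α∣≡ = begin
  A ω α                                                               ≡⟨ A-unfold ω α ∣α∣≡ ⟩
  sumDec (AFuel (suc m) ω) α                                          ≡⟨ sumDec-coord _ α ⟩
  sumBelow (length α) (λ i → ifPos (coord i α) (AFuel (suc m) ω (decr i α)))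
    ≡⟨ sumBelow-cong (length α) (λ i → ifPos-cong (coord i α) λ αᵢ≡ →
         cong (λ s → AFuel s ω (decr i α)) (sym (∣decr∣ i α αᵢ≡ ∣α∣≡))) ⟩
  sumBelow (length α) (λ i → ifPos (coord i α) (A ω (decr i α))) ∎

A₁ : Exp → ℕ
A₁ β = extendAt0 ∣ β ∣ₑ (A ones β)

A₁-decr : ∀ i β {x s} → coord i β ≡ suc x → ∣ β ∣ₑ ≡ suc s → A₁ (decr i β) ≡ extendAt0 s (A ones (decr i β))
A₁-decr i β βᵢ≡ ∣β∣≡ = cong (λ s → extendAt0 s (A ones (decr i β))) (∣decr∣ i β βᵢ≡ ∣β∣≡)

A-ones-step : ∀ β {m} → ∣ β ∣ₑ ≡ suc m →
  A ones β ≡ sumBelow (length β) (λ i → ifPos (coord i β) (A₁ (decr i β)))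
A-ones-step β {zero} ∣β∣≡ = begin
  A ones β             ≡⟨ A-unit ones β ∣β∣≡ ⟩
  sumWeight ones β     ≡⟨ sumWeight-coord ones β ⟩
  sumBelow (length β) (λ i → ifPos (coord i β) 1)
    ≡⟨ sumBelow-cong (length β) (λ i → ifPos-cong (coord i β) λ βᵢ≡ → A₁-decr i β βᵢ≡ ∣β∣≡) ⟨
  sumBelow (length β) (λ i → ifPos (coord i β) (A₁ (decr i β))) ∎
A-ones-step β {suc m} ∣β∣≡ = begin
  A ones β
    ≡⟨ A-step ones β ∣β∣≡ ⟩
  sumBelow (length β) (λ i → ifPos (coord i β) (A ones (decr i β)))
    ≡⟨ sumBelow-cong (length β) (λ i → ifPos-cong (coord i β) λ βᵢ≡ → A₁-decr i β βᵢ≡ ∣β∣≡) ⟨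
  sumBelow (length β) (λ i → ifPos (coord i β) (A₁ (decr i β))) ∎

A₁-step : ∀ β {m} → ∣ β ∣ₑ ≡ suc m →
  A₁ β ≡ sumBelow (length β) (λ i → ifPos (coord i β) (A₁ (decr i β)))
A₁-step β ∣β∣≡ = trans (cong (λ s → extendAt0 s (A ones β)) ∣β∣≡) (A-ones-step β ∣β∣≡)

A-unitW : ∀ k α → A (unitW (suc k)) α ≡ ifPos (coord k α) (A₁ (decr k α))
A-unitW k α = by-size ∣ α ∣ₑ α refl
  where
  eₖ : Weight
  eₖ = unitW (suc k)

  by-size : ∀ s α → ∣ α ∣ₑ ≡ s → A eₖ α ≡ ifPos (coord k α) (A₁ (decr k α))
  by-size zero α ∣α∣≡ = begin
    AFuel ∣ α ∣ₑ eₖ α                  ≡⟨ cong (λ s → AFuel s eₖ α) ∣α∣≡ ⟩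
    0                                  ≡⟨ cong (λ a → ifPos a (A₁ (decr k α))) (coord-∣∣≡0 k α ∣α∣≡) ⟨
    ifPos (coord k α) (A₁ (decr k α)) ∎
  by-size (suc zero) α ∣α∣≡ = begin
    A eₖ α                             ≡⟨ A-unit eₖ α ∣α∣≡ ⟩
    sumWeight eₖ α                     ≡⟨ sumWeight-unitW k α ⟩
    ifPos (coord k α) 1                ≡⟨ ifPos-cong (coord k α) (λ αₖ≡ → A₁-decr k α αₖ≡ ∣α∣≡) ⟨
    ifPos (coord k α) (A₁ (decr k α)) ∎
  by-size (suc (suc m)) α ∣α∣≡ = begin
    A eₖ α
      ≡⟨ A-step eₖ α ∣α∣≡ ⟩
    sumBelow (length α) (λ i → ifPos (coord i α) (A eₖ (decr i α)))
      ≡⟨ sumBelow-cong (length α) (λ i → ifPos-cong (coord i α) λ αᵢ≡ →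
           by-size (suc m) (decr i α) (∣decr∣ i α αᵢ≡ ∣α∣≡)) ⟩
    sumBelow (length α) (λ i → ifPos (coord i α) (ifPos (coord k (decr i α)) (A₁ (decr k (decr i α)))))
      ≡⟨ sumBelow-cong (length α) (λ i → trans
           (cong (λ β → ifPos (coord i α) (ifPos (coord k (decr i α)) (A₁ β))) (decr-comm i k α))
           (ifPos-coord-decr-swap i k α _)) ⟩
    sumBelow (length α) (λ i → ifPos (coord k α) (ifPos (coord i (decr k α)) (A₁ (decr i (decr k α)))))
      ≡⟨ sumBelow-ifPos (length α) (coord k α) _ ⟩
    ifPos (coord k α) (unfoldedAt (length α))
      ≡⟨ cong (λ n → ifPos (coord k α) (unfoldedAt n)) (length-decr k α) ⟨
    ifPos (coord k α) (unfoldedAt (length (decr k α)))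
      ≡⟨ ifPos-cong (coord k α) (λ αₖ≡ → A₁-step (decr k α) (∣decr∣ k α αₖ≡ ∣α∣≡)) ⟨
    ifPos (coord k α) (A₁ (decr k α)) ∎
    where
    unfoldedAt : ℕ → ℕ
    unfoldedAt n = sumBelow n (λ i → ifPos (coord i (decr k α)) (A₁ (decr i (decr k α))))

F-level : ∀ m β → F m β ≡ (if level β ≡ᵇ m then A₁ β else 0)
F-level zero    β = level-zero
  where
  level-zero : (if ∣ β ∣ₑ ≡ᵇ 0 then 1 else 0) ≡ (if level β ≡ᵇ 0 then extendAt0 ∣ β ∣ₑ (A ones β) else 0)
  level-zero with ∣ β ∣ₑ in ∣β∣≡ | level β in level≡
  ... | zero  | zero  = refl
  ... | zero  | suc _ = contradiction (trans (sym level≡) (∣∣≡0⇒levelFrom≡0 0 β ∣β∣≡)) 1+n≢0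
  ... | suc _ | zero  = contradiction (trans (sym ∣β∣≡) (levelFrom≡0⇒∣∣≡0 0 β level≡)) 1+n≢0
  ... | suc _ | suc _ = refl
F-level (suc m) β = level-suc
  where
  level-suc : (if level β ≡ᵇ suc m then A ones β else 0)
            ≡ (if level β ≡ᵇ suc m then extendAt0 ∣ β ∣ₑ (A ones β) else 0)
  level-suc with ∣ β ∣ₑ in ∣β∣≡
  ... | zero  rewrite ∣∣≡0⇒levelFrom≡0 0 β ∣β∣≡ = refl
  ... | suc _ = refl

+-≡ᵇ : ∀ l {j n} → j ≤ n → (l + j ≡ᵇ n) ≡ (l ≡ᵇ n ∸ j)
+-≡ᵇ l {zero}  {n}     _         = cong (_≡ᵇ n) (+-identityʳ l)
+-≡ᵇ l {suc j} {suc n} (s≤s j≤n) = trans (cong (_≡ᵇ suc n) (+-suc l j)) (+-≡ᵇ l j≤n)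

F-∸-decr : ∀ n k α {x} → suc k ≤ n → coord k α ≡ suc x →
  F (n ∸ suc k) (decr k α) ≡ (if level α ≡ᵇ n then A₁ (decr k α) else 0)
F-∸-decr n k α j≤n αₖ≡ = begin
  F (n ∸ suc k) (decr k α)                                       ≡⟨ F-level (n ∸ suc k) (decr k α) ⟩
  (if level (decr k α) ≡ᵇ n ∸ suc k then A₁ (decr k α) else 0)   ≡⟨ cong (λ b → if b then A₁ (decr k α) else 0) level-test ⟩
  (if level α ≡ᵇ n then A₁ (decr k α) else 0)                    ∎
  where
  level-test : (level (decr k α) ≡ᵇ n ∸ suc k) ≡ (level α ≡ᵇ n)
  level-test = begin
    (level (decr k α) ≡ᵇ n ∸ suc k)  ≡⟨ +-≡ᵇ (level (decr k α)) j≤n ⟨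
    (level (decr k α) + suc k ≡ᵇ n)  ≡⟨ cong (_≡ᵇ n) (levelFrom-decr 0 k α αₖ≡) ⟨
    (level α ≡ᵇ n)                   ∎

lemma2 : (n j : ℕ) → 1 ≤ n → 1 ≤ j → j ≤ n →
    (α : Exp) → mulT j (F (n ∸ j)) α ≡ P n (unitW j) α
lemma2 n (suc k) _ _ j≤n α = begin
  mulT₀ k (F (n ∸ suc k)) α                                        ≡⟨ mulT₀-coord k _ α ⟩
  ifPos (coord k α) (F (n ∸ suc k) (decr k α))                     ≡⟨ ifPos-cong (coord k α) (F-∸-decr n k α j≤n) ⟩
  ifPos (coord k α) (if level α ≡ᵇ n then A₁ (decr k α) else 0)    ≡⟨ ifPos-if (coord k α) (level α ≡ᵇ n) _ ⟩
  (if level α ≡ᵇ n then ifPos (coord k α) (A₁ (decr k α)) else 0)  ≡⟨ cong (λ a → if level α ≡ᵇ n then a else 0) (A-unitW k α) ⟨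
  P n (unitW (suc k)) α                                            ∎
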